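{- Let $r\geq 6$ and let $c:E(K_r)\to\{1,\dots,r\}$ be a parallel $r$-coloring. Then there are at most $r\binom{\lfloor r/2\rfloor}{2}$ non-rainbow copies of $K_4$ in $K_r$ under $c$.
   Context: A parallel $r$-coloring of $E(K_r)$ is a surjective map $c:E(K_r)\to\{1,\dots,r\}$ such that each color class is a matching (no two edges of the same color share a vertex). A copy of $K_4$ is rainbow if its six edges receive pairwise distinct colors, and non-rainbow otherwise. -}

module Defs where

open import Data.Nat using (ℕ; _≤_; _*_; _/_)
open import Data.Nat.Combinatorics using (_C_)
open import Data.Fin using (Fin; _<_; _<?_)
open import Data.Fin.Properties using (_≟_)
open import Data.List using (List; []; _∷_; length; filter; allFin; concatMap; map)
open import Data.Product using (Σ; _×_; _,_; ∃₂)
open import Data.Bool using (Bool; true; false)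
open import Relation.Binary.PropositionalEquality using (_≡_; _≢_)
open import Relation.Nullary using (¬_; Dec; yes; no)
open import Relation.Nullary.Decidable using (_×-dec_; ¬?)
open import Data.List.Relation.Unary.AllPairs using (AllPairs; allPairs?)

-- A colouring of E(K_r) with colours {1,…,r} (represented as Fin r),
-- given as a function on ordered pairs of distinct vertices of K_r
-- (vertex set Fin r); values on the diagonal are irrelevant.
Coloring : ℕ → Set
Coloring r = Fin r → Fin r → Fin r

Symmetric : {r : ℕ} → Coloring r → Set
Symmetric {r} c = ∀ (i j : Fin r) → i ≢ j → c i j ≡ c j i

ColorClassesMatchings : {r : ℕ} → Coloring r → Set
ColorClassesMatchings {r} c =
  ∀ (i j k : Fin r) → i ≢ j → i ≢ k → j ≢ k → c i j ≢ c i k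

Surjective : {r : ℕ} → Coloring r → Set
Surjective {r} c = ∀ (a : Fin r) → ∃₂ λ i j → i ≢ j × c i j ≡ a

IsParallelColoring : {r : ℕ} → Coloring r → Set
IsParallelColoring c = Symmetric c × ColorClassesMatchings c × Surjective c

-- copies of K_4 in K_r: 4-element vertex sets, listed as a < b < d < e
record Quad (r : ℕ) : Set where
  constructor quad
  field
    a b d e : Fin r

quads : (r : ℕ) → List (Quad r)
quads r =
  filter (λ q → let open Quad q in (a <? b) ×-dec (b <? d) ×-dec (d <? e))
    (concatMap (λ a → concatMap (λ b → concatMap (λ d → map (λ e → quad a b d e)
       (allFin r)) (allFin r)) (allFin r)) (allFin r))

edgeColors : {r : ℕ} → Coloring r → Quad r → List (Fin r)
edgeColors c (quad a b d e) =
  c a b ∷ c a d ∷ c a e ∷ c b d ∷ c b e ∷ c d e ∷ []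

Rainbow : {r : ℕ} → Coloring r → Quad r → Set
Rainbow c q = AllPairs _≢_ (edgeColors c q)

rainbow? : {r : ℕ} → (c : Coloring r) → (q : Quad r) → Dec (Rainbow c q)
rainbow? c q = allPairs? (λ x y → ¬? (x ≟ y)) (edgeColors c q)

nonRainbowCount : {r : ℕ} → Coloring r → ℕ
nonRainbowCount {r} c = length (filter (λ q → ¬? (rainbow? c q)) (quads r))

-- Two edges sharing a vertex get different colours, so a copy of K₄ fails to be
-- rainbow exactly when one of its three perfect matchings is monochromatic.
-- Such a copy is therefore determined by a colour together with two edges of
-- that colour.  Each colour class is a matching, hence has at most ⌊r/2⌋ edges,
-- which leaves at most r · C(⌊r/2⌋, 2) choices.
module Submission where

open import Defs
open import Data.Nat using (ℕ; zero; suc; _+_; _*_; _/_; _≤_; z≤n; s≤s; _≤′_; ≤′-refl; ≤′-step)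
open import Data.Nat.Combinatorics using (_C_; nCk+nC[k+1]≡[n+1]C[k+1]; nC1≡n)
open import Data.Nat.DivMod using (m*n/n≡m; /-monoˡ-≤)
open import Data.Nat.Properties as ℕ
  using (≤-refl; ≤-trans; ≤-reflexive; +-mono-≤; m≤n+m; +-suc; m≤n⇒m≤1+n; ≤⇒≤′; *-comm; +-identityʳ)
open import Data.Fin using (Fin; zero; suc; _<_; _<?_)
open import Data.Fin.Properties using (_≟_; any?; <⇒≢; <-trans; <-asym; injective⇒≤)
open import Data.List using (List; []; _∷_; length; filter; allFin; concatMap; map; lookup; _++_)
open import Data.List.Properties using (length-++; length-map; length-tabulate)
open import Data.List.Membership.Propositional using (_∈_)
open import Data.List.Membership.Propositional.Properties
  using (∈-lookup; ∈-filter⁻; ∈-filter⁺; ∈-allFin; ∈-map⁺; ∈-concatMap⁺; ∈-++⁺ˡ; ∈-++⁺ʳ)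
open import Data.List.Relation.Binary.Subset.Propositional using (_⊆_)
open import Data.List.Relation.Binary.Disjoint.Propositional using (Disjoint)
open import Data.List.Relation.Unary.Any as Any using (here; there; index)
open import Data.List.Relation.Unary.Any.Properties using (lookup-index)
open import Data.List.Relation.Unary.All as All using (All; []; _∷_)
import Data.List.Relation.Unary.All.Properties as All
open import Data.List.Relation.Unary.AllPairs as AllPairs using ([]; _∷_)
import Data.List.Relation.Unary.AllPairs.Properties as AllPairs
open import Data.List.Relation.Unary.Unique.Propositional using (Unique)
import Data.List.Relation.Unary.Unique.Propositional.Properties as Unique
open import Data.Product using (∃; _×_; _,_; proj₁; proj₂)
open import Data.Sum using (_⊎_; inj₁; inj₂)
open import Data.Empty using (⊥-elim)
open import Function.Base using (id)
open import Function.Definitions using (Injective)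
open import Relation.Binary.PropositionalEquality
  using (_≡_; _≢_; refl; sym; trans; cong; cong₂; subst; ≢-sym; module ≡-Reasoning)
open import Relation.Nullary using (¬_; Dec; yes; no)
open import Relation.Nullary.Decidable using (_×-dec_; ¬?)
open import Relation.Unary using (Decidable)

module _ {A : Set} where

  lookup-injective : ∀ {xs : List A} → Unique xs →
                     ∀ {i j} → lookup xs i ≡ lookup xs j → i ≡ j
  lookup-injective (_ ∷ _)      {zero}  {zero}  _  = refl
  lookup-injective (x∉xs ∷ _)   {zero}  {suc j} eq = ⊥-elim (All.lookup x∉xs (∈-lookup j) eq)
  lookup-injective (x∉xs ∷ _)   {suc i} {zero}  eq = ⊥-elim (All.lookup x∉xs (∈-lookup i) (sym eq))
  lookup-injective (_ ∷ xs!)    {suc i} {suc j} eq = cong suc (lookup-injective xs! eq)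

  Unique-⊆⇒length-≤ : ∀ {xs ys : List A} → Unique xs → xs ⊆ ys → length xs ≤ length ys
  Unique-⊆⇒length-≤ {xs} {ys} xs! xs⊆ys = injective⇒≤ position-injective
    where
    position : Fin (length xs) → Fin (length ys)
    position i = index (xs⊆ys (∈-lookup i))

    position-injective : Injective _≡_ _≡_ position
    position-injective {i} {j} eq = lookup-injective xs! (begin
      lookup xs i            ≡⟨ lookup-index (xs⊆ys (∈-lookup i)) ⟩
      lookup ys (position i) ≡⟨ cong (lookup ys) eq ⟩
      lookup ys (position j) ≡⟨ sym (lookup-index (xs⊆ys (∈-lookup j))) ⟩
      lookup xs j            ∎)
      where open ≡-Reasoning

  length-filter-disjoint : {P Q : A → Set} (P? : Decidable P) (Q? : Decidable Q) →
    (∀ x → P x → ¬ Q x) → ∀ xs → length (filter P? xs) + length (filter Q? xs) ≤ length xs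
  length-filter-disjoint P? Q? P⇒¬Q [] = z≤n
  length-filter-disjoint P? Q? P⇒¬Q (x ∷ xs) with P? x | Q? x | length-filter-disjoint P? Q? P⇒¬Q xs
  ... | yes p | yes q | _  = ⊥-elim (P⇒¬Q x p q)
  ... | yes _ | no _  | ih = s≤s ih
  ... | no _  | yes _ | ih = subst (_≤ suc (length xs)) (sym (+-suc _ _)) (s≤s ih)
  ... | no _  | no _  | ih = m≤n⇒m≤1+n ih

  length-concatMap-≤ : {B : Set} (f : A → List B) {bound : ℕ} → (∀ x → length (f x) ≤ bound) →
                       ∀ xs → length (concatMap f xs) ≤ length xs * bound
  length-concatMap-≤ f f≤ [] = z≤n
  length-concatMap-≤ f f≤ (x ∷ xs) rewrite length-++ (f x) {concatMap f xs} =
    +-mono-≤ (f≤ x) (length-concatMap-≤ f f≤ xs)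

  pairs : List A → List (A × A)
  pairs [] = []
  pairs (x ∷ xs) = map (x ,_) xs ++ pairs xs

  length-pairs : ∀ xs → length (pairs xs) ≡ length xs C 2
  length-pairs [] = refl
  length-pairs (x ∷ xs) = begin
    length (map (x ,_) xs ++ pairs xs)        ≡⟨ length-++ (map (x ,_) xs) ⟩
    length (map (x ,_) xs) + length (pairs xs) ≡⟨ cong₂ _+_ (length-map (x ,_) xs) (length-pairs xs) ⟩
    length xs + length xs C 2                 ≡⟨ cong (_+ length xs C 2) (sym (nC1≡n (length xs))) ⟩
    length xs C 1 + length xs C 2             ≡⟨ nCk+nC[k+1]≡[n+1]C[k+1] (length xs) 1 ⟩
    suc (length xs) C 2                       ∎
    where open ≡-Reasoning

  ∈-pairs⁺ : ∀ {x y xs} → x ∈ xs → y ∈ xs → x ≢ y → (x , y) ∈ pairs xs ⊎ (y , x) ∈ pairs xs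
  ∈-pairs⁺ (here refl) (here refl) x≢y = ⊥-elim (x≢y refl)
  ∈-pairs⁺ {xs = z ∷ zs} (here refl) (there y∈) _ = inj₁ (∈-++⁺ˡ (∈-map⁺ (z ,_) y∈))
  ∈-pairs⁺ {xs = z ∷ zs} (there x∈) (here refl) _ = inj₂ (∈-++⁺ˡ (∈-map⁺ (z ,_) x∈))
  ∈-pairs⁺ {xs = z ∷ zs} (there x∈) (there y∈) x≢y with ∈-pairs⁺ x∈ y∈ x≢y
  ... | inj₁ xy∈ = inj₁ (∈-++⁺ʳ (map (z ,_) zs) xy∈)
  ... | inj₂ yx∈ = inj₂ (∈-++⁺ʳ (map (z ,_) zs) yx∈)

All-concatMap⁺ : {A B : Set} {P : B → Set} {f : A → List B} → (∀ x → All P (f x)) →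
                 ∀ xs → All P (concatMap f xs)
All-concatMap⁺ Pf xs = All.concat⁺ (All.map⁺ (All.universal Pf xs))

module _ {A B : Set} (f : A → List B) (key : B → A) where

  Unique-concatMap⁺ : (∀ x → All (λ y → key y ≡ x) (f x)) → (∀ x → Unique (f x)) →
                      ∀ {xs} → Unique xs → Unique (concatMap f xs)
  Unique-concatMap⁺ keyed f! xs! =
    Unique.concat⁺ (All.map⁺ (All.universal f! _)) (AllPairs.map⁺ (AllPairs.map disjoint xs!))
    where
    disjoint : ∀ {x x′} → x ≢ x′ → Disjoint (f x) (f x′)
    disjoint x≢x′ (y∈fx , y∈fx′) =
      x≢x′ (trans (sym (All.lookup (keyed _) y∈fx)) (All.lookup (keyed _) y∈fx′))

nCk≤[1+n]Ck : ∀ n k → n C k ≤ suc n C k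
nCk≤[1+n]Ck n zero    = ≤-refl
nCk≤[1+n]Ck n (suc k) = subst (n C suc k ≤_) (nCk+nC[k+1]≡[n+1]C[k+1] n k) (m≤n+m (n C suc k) (n C k))

C-monoˡ-≤ : ∀ k {m n} → m ≤ n → m C k ≤ n C k
C-monoˡ-≤ k m≤n = go (≤⇒≤′ m≤n)
  where
  go : ∀ {m n} → m ≤′ n → m C k ≤ n C k
  go ≤′-refl       = ≤-refl
  go (≤′-step m≤n) = ≤-trans (go m≤n) (nCk≤[1+n]Ck _ k)

m+m≤n⇒m≤n/2 : ∀ {m n} → m + m ≤ n → m ≤ n / 2
m+m≤n⇒m≤n/2 {m} {n} m+m≤n = subst (_≤ n / 2) (m*n/n≡m m 2) (/-monoˡ-≤ 2 (subst (_≤ n) m+m≡m*2 m+m≤n))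
  where
  m+m≡m*2 : m + m ≡ m * 2
  m+m≡m*2 = trans (cong (m +_) (sym (+-identityʳ m))) (*-comm 2 m)

module _ {r : ℕ} where

  -- Merges the sorted pairs x < x′ and y < y′, given x < y.
  mergePairs : Fin r → Fin r → Fin r → Fin r → Quad r
  mergePairs x x′ y y′ with x′ <? y
  ... | yes _ = quad x x′ y y′
  ... | no _ with x′ <? y′
  ...   | yes _ = quad x y x′ y′
  ...   | no _  = quad x y y′ x′

  mergePairs-disjoint : ∀ {a b d e} → b < d → mergePairs a b d e ≡ quad a b d e
  mergePairs-disjoint {b = b} {d} b<d with b <? d
  ... | yes _   = refl
  ... | no b≮d = ⊥-elim (b≮d b<d)

  mergePairs-crossing : ∀ {a b d e} → b < d → d < e → mergePairs a d b e ≡ quad a b d e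
  mergePairs-crossing {b = b} {d} {e} b<d d<e with d <? b
  ... | yes d<b = ⊥-elim (<-asym d<b b<d)
  ... | no _ with d <? e
  ...   | yes _   = refl
  ...   | no d≮e = ⊥-elim (d≮e d<e)

  mergePairs-nested : ∀ {a b d e} → b < e → d < e → mergePairs a e b d ≡ quad a b d e
  mergePairs-nested {b = b} {d} {e} b<e d<e with e <? b
  ... | yes e<b = ⊥-elim (<-asym e<b b<e)
  ... | no _ with e <? d
  ...   | yes e<d = ⊥-elim (<-asym e<d d<e)
  ...   | no _    = refl

  -- quads r is, definitionally, a filter of concatMap withPrefix₁ (allFin r).
  withPrefix₃ : Fin r → Fin r → Fin r → List (Quad r)
  withPrefix₃ a b d = map (quad a b d) (allFin r)

  withPrefix₂ : Fin r → Fin r → List (Quad r)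
  withPrefix₂ a b = concatMap (withPrefix₃ a b) (allFin r)

  withPrefix₁ : Fin r → List (Quad r)
  withPrefix₁ a = concatMap (withPrefix₂ a) (allFin r)

  ∈-quads⁻ : ∀ {a b d e} → quad a b d e ∈ quads r → a < b × b < d × d < e
  ∈-quads⁻ q∈ = proj₂ (∈-filter⁻ (λ q → let open Quad q in (a <? b) ×-dec (b <? d) ×-dec (d <? e))
                                  {xs = concatMap withPrefix₁ (allFin r)} q∈)

  quads-Unique : Unique (quads r)
  quads-Unique = Unique.filter⁺ _ (Unique-concatMap⁺ withPrefix₁ Quad.a (λ _ → a-keyed)
    (λ a → Unique-concatMap⁺ (withPrefix₂ a) Quad.b (λ _ → b-keyed)
      (λ b → Unique-concatMap⁺ (withPrefix₃ a b) Quad.d (λ _ → d-keyed) (λ d → withPrefix₃-Unique) fins!)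
      fins!)
    fins!)
    where
    fins! = Unique.allFin⁺ r

    withPrefix₃-Unique : ∀ {a b d} → Unique (withPrefix₃ a b d)
    withPrefix₃-Unique = Unique.map⁺ (λ { refl → refl }) fins!

    prefix≡ : ∀ {a b d} → All (λ q → Quad.a q ≡ a × Quad.b q ≡ b × Quad.d q ≡ d) (withPrefix₃ a b d)
    prefix≡ = All.map⁺ (All.universal (λ _ → refl , refl , refl) _)

    d-keyed : ∀ {a b d} → All (λ q → Quad.d q ≡ d) (withPrefix₃ a b d)
    d-keyed = All.map (λ (_ , _ , q≡) → q≡) prefix≡

    b-keyed : ∀ {a b} → All (λ q → Quad.b q ≡ b) (withPrefix₂ a b)
    b-keyed {a} {b} =
      All-concatMap⁺ {f = withPrefix₃ a b} (λ _ → All.map (λ (_ , q≡ , _) → q≡) prefix≡) (allFin r)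

    a-keyed : ∀ {a} → All (λ q → Quad.a q ≡ a) (withPrefix₁ a)
    a-keyed {a} = All-concatMap⁺ {f = withPrefix₂ a}
      (λ b → All-concatMap⁺ {f = withPrefix₃ a b} (λ _ → All.map proj₁ prefix≡) (allFin r)) (allFin r)

module ParallelColouring {r : ℕ} (c : Coloring r) (c-sym : Symmetric c)
                         (matching : ColorClassesMatchings c) where

  adjacentˡˡ : ∀ {u v w} → u ≢ v → u ≢ w → v ≢ w → c u v ≢ c u w
  adjacentˡˡ = matching _ _ _

  adjacentʳˡ : ∀ {u v w} → u ≢ v → u ≢ w → v ≢ w → c v u ≢ c u w
  adjacentʳˡ {u} {v} u≢v u≢w v≢w eq = matching u v _ u≢v u≢w v≢w (trans (c-sym u v u≢v) eq)

  adjacentʳʳ : ∀ {u v w} → u ≢ v → u ≢ w → v ≢ w → c v u ≢ c w u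
  adjacentʳʳ {u} {v} {w} u≢v u≢w v≢w eq =
    matching u v w u≢v u≢w v≢w (trans (c-sym u v u≢v) (trans eq (c-sym w u (≢-sym u≢w))))

  matchingsHeterochromatic⇒Rainbow : ∀ {a b d e} → a < b → b < d → d < e →
    c a b ≢ c d e → c a d ≢ c b e → c a e ≢ c b d → Rainbow c (quad a b d e)
  matchingsHeterochromatic⇒Rainbow a<b b<d d<e ab≢de ad≢be ae≢bd =
      (adjacentˡˡ a≢b a≢d b≢d ∷ adjacentˡˡ a≢b a≢e b≢e ∷ adjacentʳˡ b≢a b≢d a≢d
        ∷ adjacentʳˡ b≢a b≢e a≢e ∷ ab≢de ∷ [])
    ∷ (adjacentˡˡ a≢d a≢e d≢e ∷ adjacentʳʳ d≢a d≢b a≢b ∷ ad≢be ∷ adjacentʳˡ d≢a d≢e a≢e ∷ [])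
    ∷ (ae≢bd ∷ adjacentʳʳ e≢a e≢b a≢b ∷ adjacentʳʳ e≢a e≢d a≢d ∷ [])
    ∷ (adjacentˡˡ b≢d b≢e d≢e ∷ adjacentʳˡ d≢b d≢e b≢e ∷ [])
    ∷ (adjacentʳʳ e≢b e≢d b≢d ∷ [])
    ∷ [] ∷ []
    where
    a<d = <-trans a<b b<d
    b<e = <-trans b<d d<e
    a<e = <-trans a<d d<e
    a≢b = <⇒≢ a<b ; a≢d = <⇒≢ a<d ; a≢e = <⇒≢ a<e
    b≢d = <⇒≢ b<d ; b≢e = <⇒≢ b<e ; d≢e = <⇒≢ d<e
    b≢a = ≢-sym a≢b ; d≢a = ≢-sym a≢d ; e≢a = ≢-sym a≢e
    d≢b = ≢-sym b≢d ; e≢b = ≢-sym b≢e ; e≢d = ≢-sym d≢e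

  ¬Rainbow⇒monochromaticMatching : ∀ {a b d e} → a < b → b < d → d < e →
    ¬ Rainbow c (quad a b d e) → c a b ≡ c d e ⊎ c a d ≡ c b e ⊎ c a e ≡ c b d
  ¬Rainbow⇒monochromaticMatching {a} {b} {d} {e} a<b b<d d<e ¬rainbow
    with c a b ≟ c d e | c a d ≟ c b e | c a e ≟ c b d
  ... | yes ab≡de | _          | _          = inj₁ ab≡de
  ... | no _      | yes ad≡be  | _          = inj₂ (inj₁ ad≡be)
  ... | no _      | no _       | yes ae≡bd  = inj₂ (inj₂ ae≡bd)
  ... | no ab≢de  | no ad≢be   | no ae≢bd   =
    ⊥-elim (¬rainbow (matchingsHeterochromatic⇒Rainbow a<b b<d d<e ab≢de ad≢be ae≢bd))

  edgeOfColourAt? : (col v : Fin r) → Dec (∃ λ w → w ≢ v × c v w ≡ col)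
  edgeOfColourAt? col v = any? (λ w → ¬? (w ≟ v) ×-dec (c v w ≟ col))

  -- The other end of the edge of colour col at v, or v itself if there is none.
  partner : Fin r → Fin r → Fin r
  partner col v with edgeOfColourAt? col v
  ... | yes (w , _) = w
  ... | no _        = v

  partner-unique : ∀ {col v w} → w ≢ v → c v w ≡ col → partner col v ≡ w
  partner-unique {col} {v} {w} w≢v vw≡col with edgeOfColourAt? col v
  ... | no ∄w = ⊥-elim (∄w (w , w≢v , vw≡col))
  ... | yes (w′ , w′≢v , vw′≡col) with w′ ≟ w
  ...   | yes w′≡w = w′≡w
  ...   | no w′≢w  =
    ⊥-elim (matching v w′ w (≢-sym w′≢v) (≢-sym w≢v) w′≢w (trans vw′≡col (sym vw≡col)))

  partner-colour : ∀ {col v} → partner col v ≢ v → c v (partner col v) ≡ col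
  partner-colour {col} {v} p≢v with edgeOfColourAt? col v
  ... | yes (_ , _ , vw≡col) = vw≡col
  ... | no _                 = ⊥-elim (p≢v refl)

  partner-involutive : ∀ {col v} → partner col v ≢ v → partner col (partner col v) ≡ v
  partner-involutive {v = v} p≢v =
    partner-unique (≢-sym p≢v) (trans (c-sym _ v p≢v) (partner-colour p≢v))

  -- Each edge of colour col is recorded by its smaller end.
  lowerEnds upperEnds : Fin r → List (Fin r)
  lowerEnds col = filter (λ v → v <? partner col v) (allFin r)
  upperEnds col = filter (λ v → partner col v <? v) (allFin r)

  edge⇒lowerEnd : ∀ {col x x′} → x < x′ → c x x′ ≡ col → x ∈ lowerEnds col × partner col x ≡ x′
  edge⇒lowerEnd {x = x} {x′} x<x′ xx′≡col =
    ∈-filter⁺ (λ v → v <? partner _ v) (∈-allFin x) (subst (x <_) (sym p≡x′) x<x′) , p≡x′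
    where p≡x′ = partner-unique (≢-sym (<⇒≢ x<x′)) xx′≡col

  lowerEnds⊆partners : ∀ col → lowerEnds col ⊆ map (partner col) (upperEnds col)
  lowerEnds⊆partners col {v} v∈ = subst (_∈ map (partner col) (upperEnds col)) pw≡v
    (∈-map⁺ (partner col)
      (∈-filter⁺ (λ u → partner col u <? u) (∈-allFin w) (subst (_< w) (sym pw≡v) v<w)))
    where
    w   = partner col v
    v<w = proj₂ (∈-filter⁻ (λ u → u <? partner col u) {xs = allFin r} v∈)
    pw≡v = partner-involutive (≢-sym (<⇒≢ v<w))

  length-lowerEnds≤r/2 : ∀ col → length (lowerEnds col) ≤ r / 2
  length-lowerEnds≤r/2 col = m+m≤n⇒m≤n/2 (begin
    length (lowerEnds col) + length (lowerEnds col) ≤⟨ +-mono-≤ ≤-refl lower≤upper ⟩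
    length (lowerEnds col) + length (upperEnds col) ≤⟨ length-filter-disjoint _ _ (λ _ → <-asym) (allFin r) ⟩
    length (allFin r)                               ≡⟨ length-tabulate {n = r} id ⟩
    r                                               ∎)
    where
    open ℕ.≤-Reasoning
    lower≤upper : length (lowerEnds col) ≤ length (upperEnds col)
    lower≤upper = ≤-trans
      (Unique-⊆⇒length-≤ (Unique.filter⁺ _ (Unique.allFin⁺ r)) (lowerEnds⊆partners col))
      (≤-reflexive (length-map (partner col) (upperEnds col)))

  colourCodes : Fin r → List (Fin r × Fin r × Fin r)
  colourCodes col = map (col ,_) (pairs (lowerEnds col))

  codes : List (Fin r × Fin r × Fin r)
  codes = concatMap colourCodes (allFin r)

  length-colourCodes≤[r/2]C2 : ∀ col → length (colourCodes col) ≤ (r / 2) C 2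
  length-colourCodes≤[r/2]C2 col = begin
    length (map (col ,_) (pairs (lowerEnds col))) ≡⟨ length-map (col ,_) (pairs (lowerEnds col)) ⟩
    length (pairs (lowerEnds col))                ≡⟨ length-pairs (lowerEnds col) ⟩
    length (lowerEnds col) C 2                    ≤⟨ C-monoˡ-≤ 2 (length-lowerEnds≤r/2 col) ⟩
    (r / 2) C 2                                   ∎
    where open ℕ.≤-Reasoning

  length-codes≤r*[r/2]C2 : length codes ≤ r * ((r / 2) C 2)
  length-codes≤r*[r/2]C2 = begin
    length codes                      ≤⟨ length-concatMap-≤ colourCodes length-colourCodes≤[r/2]C2 (allFin r) ⟩
    length (allFin r) * ((r / 2) C 2) ≡⟨ cong (_* ((r / 2) C 2)) (length-tabulate {n = r} id) ⟩
    r * ((r / 2) C 2)                 ∎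
    where open ℕ.≤-Reasoning

  decode : Fin r × Fin r × Fin r → Quad r
  decode (col , x , y) with x <? y
  ... | yes _ = mergePairs x (partner col x) y (partner col y)
  ... | no _  = mergePairs y (partner col y) x (partner col x)

  decode-ordered : ∀ {col x y} → x < y →
                   decode (col , x , y) ≡ mergePairs x (partner col x) y (partner col y)
  decode-ordered {x = x} {y} x<y with x <? y
  ... | yes _   = refl
  ... | no x≮y = ⊥-elim (x≮y x<y)

  decode-swapped : ∀ {col x y} → x < y →
                   decode (col , y , x) ≡ mergePairs x (partner col x) y (partner col y)
  decode-swapped {x = x} {y} x<y with y <? x
  ... | yes y<x = ⊥-elim (<-asym x<y y<x)
  ... | no _    = refl

  ∈-codes⁺ : ∀ {col xy} → xy ∈ pairs (lowerEnds col) → (col , xy) ∈ codes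
  ∈-codes⁺ {col} xy∈ =
    ∈-concatMap⁺ colourCodes (Any.map (λ { refl → ∈-map⁺ (col ,_) xy∈ }) (∈-allFin col))

  monochromaticMatching∈decoded : ∀ {col x x′ y y′} → x < x′ → y < y′ → x < y →
    c x x′ ≡ col → c y y′ ≡ col → mergePairs x x′ y y′ ∈ map decode codes
  monochromaticMatching∈decoded x<x′ y<y′ x<y xx′≡col yy′≡col
    with edge⇒lowerEnd x<x′ xx′≡col | edge⇒lowerEnd y<y′ yy′≡col
  ... | x∈ , refl | y∈ , refl with ∈-pairs⁺ x∈ y∈ (<⇒≢ x<y)
  ...   | inj₁ xy∈ = subst (_∈ map decode codes) (decode-ordered x<y) (∈-map⁺ decode (∈-codes⁺ xy∈))
  ...   | inj₂ yx∈ = subst (_∈ map decode codes) (decode-swapped x<y) (∈-map⁺ decode (∈-codes⁺ yx∈))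

  nonRainbow⊆decoded : filter (λ q → ¬? (rainbow? c q)) (quads r) ⊆ map decode codes
  nonRainbow⊆decoded {quad a b d e} q∈ with ∈-filter⁻ (λ q → ¬? (rainbow? c q)) {xs = quads r} q∈
  ... | q∈quads , ¬rainbow with ∈-quads⁻ q∈quads
  ... | a<b , b<d , d<e with ¬Rainbow⇒monochromaticMatching a<b b<d d<e ¬rainbow
  ... | inj₁ ab≡de = subst (_∈ map decode codes) (mergePairs-disjoint b<d)
          (monochromaticMatching∈decoded a<b d<e (<-trans a<b b<d) refl (sym ab≡de))
  ... | inj₂ (inj₁ ad≡be) = subst (_∈ map decode codes) (mergePairs-crossing b<d d<e)
          (monochromaticMatching∈decoded (<-trans a<b b<d) (<-trans b<d d<e) a<b refl (sym ad≡be))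
  ... | inj₂ (inj₂ ae≡bd) = subst (_∈ map decode codes) (mergePairs-nested (<-trans b<d d<e) d<e)
          (monochromaticMatching∈decoded (<-trans (<-trans a<b b<d) d<e) b<d a<b refl (sym ae≡bd))

  nonRainbowCount≤r*[r/2]C2 : nonRainbowCount c ≤ r * ((r / 2) C 2)
  nonRainbowCount≤r*[r/2]C2 = begin
    nonRainbowCount c            ≤⟨ Unique-⊆⇒length-≤ (Unique.filter⁺ _ quads-Unique) nonRainbow⊆decoded ⟩
    length (map decode codes)    ≡⟨ length-map decode codes ⟩
    length codes                 ≤⟨ length-codes≤r*[r/2]C2 ⟩
    r * ((r / 2) C 2)            ∎
    where open ℕ.≤-Reasoning

lemma6 : (r : ℕ) → 6 ≤ r → (c : Coloring r) → IsParallelColoring c →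
    nonRainbowCount c ≤ r * ((r / 2) C 2)
lemma6 r _ c (c-sym , matching , _) = ParallelColouring.nonRainbowCount≤r*[r/2]C2 c c-sym matching
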